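{- Let $I$ be a modal intuitionistic formula, $\varphi(x)=ST_{22}(I,x)$ and $k=r(\varphi)$. Let $\Sigma_\varphi\subseteq\Theta$, let $(M_1,t),(M_2,u)$ be pointed $\Theta$-models, let $l\in\mathbb{N}$, and let $(A,B)$ be a $(2,2)$-modal $\langle(M_1,t),(M_2,u)\rangle_l$-asimulation. Then for all $\mu,\nu\in\{1,2\}$, all $m\ge0$, all $(a_1,\dots,a_m,a)\in U_\mu^{m+1}$ and $(b_1,\dots,b_m,b)\in U_\nu^{m+1}$: if $(a_1,\dots,a_m,a)\mathrel{A}(b_1,\dots,b_m,b)$, $m+k\le l$ and $M_\mu,a\models\varphi(x)$, then $M_\nu,b\models\varphi(x)$.
   Context: Correspondence language: classical first-order logic without identity over $\Sigma=\{R,R_\Box,R_\Diamond,P_1,P_2,\dots\}$, $R,R_\Box,R_\Diamond$ binary, $P_n$ unary. For $\Theta\subseteq\Sigma$ containing $R,R_\Box,R_\Diamond$, a $\Theta$-model $M_\mu=\langle U_\mu,\iota_\mu\rangle$ is a classical structure for $\Theta$; write $R_\mu,R_{\Box\mu},R_{\Diamond\mu}$ for the interpretations. $\Sigma_\varphi=\{R,R_\Box,R_\Diamond\}\cup\{P_n:P_n\text{ occurs in }\varphi\}$. $r(\varphi)$ is the quantifier depth: $r=0$ for $\bot$ and atoms, $r(\varphi\circ\psi)=\max(r(\varphi),r(\psi))$ for binary connectives, $r(Qy\varphi)=r(\varphi)+1$. Modal intuitionistic formulas are built from letters $p_n$ and $\bot$ by $\wedge,\vee,\to,\Box,\Diamond$.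 $ST_{22}(p_n,x)=P_n(x)$, $ST_{22}(\bot,x)=\bot$, $\wedge,\vee$ componentwise, $ST_{22}(I\to J,x)=\forall y(R(x,y)\to(ST_{22}(I,y)\to ST_{22}(J,y)))$, $ST_{22}(\Box I,x)=\forall y(R(x,y)\to\forall z(R_\Box(y,z)\to ST_{22}(I,z)))$, $ST_{22}(\Diamond I,x)=\forall y(R(x,y)\to\exists z(R_\Diamond(y,z)\wedge ST_{22}(I,z)))$. A $(2,2)$-modal $\langle(M_1,t),(M_2,u)\rangle_l$-asimulation is a pair $(A,B)$ of relations such that, for all $\mu,\nu\in\{1,2\}$, $m\ge0$, $\bar a=(a_1,\dots,a_m)$ and $a,c,e$ in $U_\mu$, $\bar b=(b_1,\dots,b_m)$ and $b,d,f$ in $U_\nu$, unary $P\in\Theta$: $A,B\subseteq\bigcup_{n>0}((U_1^n\times U_2^n)\cup(U_2^n\times U_1^n))$; $(t)A(u)$; if $(\bar a,a)A(\bar b,b)$ and $M_\mu,a\models P(x)$ then $M_\nu,b\models P(x)$; if $(\bar a,a)A(\bar b,b)$, $bR_\nu d$, $m<l$, then some $c\in U_\mu$ has $aR_\mu c$, $(\bar a,a,c)A(\bar b,b,d)$ and $(\bar b,b,d)A(\bar a,a,c)$; if $(\bar a,a)A(\bar b,b)$, $bR_\nu d$, $dR_{\Box\nu}f$, $m+1<l$, then some $c,e\in U_\mu$ have $aR_\mu c$, $cR_{\Box\mu}e$, $(\bar a,a,c,e)A(\bar b,b,d,f)$; if $(\bar a,a)A(\bar b,b)$, $bR_\nu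 d$, $m+1<l$, then some $c\in U_\mu$ has $aR_\mu c$ and $(\bar a,a,c)B(\bar b,b,d)$; if $(\bar a,a)B(\bar b,b)$, $aR_{\Diamond\mu}c$, $m<l$, then some $d\in U_\nu$ has $bR_{\Diamond\nu}d$ and $(\bar a,a,c)A(\bar b,b,d)$. -}

module Defs where

open import Data.Nat using (ℕ; zero; suc; _⊔_; _<_)
open import Data.Vec using (Vec; []; _∷_; _∷ʳ_)
open import Data.Product using (Σ; _×_)
open import Data.Sum using (_⊎_)
open import Data.Empty using (⊥)
open import Relation.Binary.PropositionalEquality using (_≡_; _≢_)

data MIF : Set where
  p    : ℕ → MIF
  ⊥ᵐ   : MIF
  _∧ᵐ_ : MIF → MIF → MIF
  _∨ᵐ_ : MIF → MIF → MIF
  _⇒ᵐ_ : MIF → MIF → MIF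
  □ᵐ   : MIF → MIF
  ◇ᵐ   : MIF → MIF

-- First-order formulas over Σ = {R, R_□, R_◇, P_1, P_2, ...}
-- (no identity); variables are de Bruijn indices.

data BinSym : Set where
  `R `R□ `R◇ : BinSym

data FO : Set where
  ⊥ᶠ   : FO
  rel  : BinSym → ℕ → ℕ → FO
  pred : ℕ → ℕ → FO
  _∧ᶠ_ : FO → FO → FO
  _∨ᶠ_ : FO → FO → FO
  _⇒ᶠ_ : FO → FO → FO
  ∀ᶠ   : FO → FO
  ∃ᶠ   : FO → FO

r : FO → ℕ
r ⊥ᶠ = 0
r (rel _ _ _) = 0
r (pred _ _) = 0
r (φ ∧ᶠ ψ) = r φ ⊔ r ψ
r (φ ∨ᶠ ψ) = r φ ⊔ r ψ
r (φ ⇒ᶠ ψ) = r φ ⊔ r ψ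
r (∀ᶠ φ) = suc (r φ)
r (∃ᶠ φ) = suc (r φ)

PredOcc : ℕ → FO → Set
PredOcc n ⊥ᶠ = ⊥
PredOcc n (rel _ _ _) = ⊥
PredOcc n (pred m _) = m ≡ n
PredOcc n (φ ∧ᶠ ψ) = PredOcc n φ ⊎ PredOcc n ψ
PredOcc n (φ ∨ᶠ ψ) = PredOcc n φ ⊎ PredOcc n ψ
PredOcc n (φ ⇒ᶠ ψ) = PredOcc n φ ⊎ PredOcc n ψ
PredOcc n (∀ᶠ φ) = PredOcc n φ
PredOcc n (∃ᶠ φ) = PredOcc n φ

-- The standard translation ST_22(I, x).  Under a binder the variable x
-- becomes suc x and the freshly bound variable (y resp. z) is 0.
ST22 : MIF → ℕ → FO
ST22 (p n) x = pred n x
ST22 ⊥ᵐ x = ⊥ᶠ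
ST22 (I ∧ᵐ J) x = ST22 I x ∧ᶠ ST22 J x
ST22 (I ∨ᵐ J) x = ST22 I x ∨ᶠ ST22 J x
ST22 (I ⇒ᵐ J) x = ∀ᶠ (rel `R (suc x) 0 ⇒ᶠ (ST22 I 0 ⇒ᶠ ST22 J 0))
ST22 (□ᵐ I) x = ∀ᶠ (rel `R (suc x) 0 ⇒ᶠ ∀ᶠ (rel `R□ 1 0 ⇒ᶠ ST22 I 0))
ST22 (◇ᵐ I) x = ∀ᶠ (rel `R (suc x) 0 ⇒ᶠ ∃ᶠ (rel `R◇ 1 0 ∧ᶠ ST22 I 0))

record Model : Set₁ where
  field
    U  : Set
    R  : U → U → Set
    R□ : U → U → Set
    R◇ : U → U → Set
    P  : ℕ → U → Set
open Model public

interpB : (M : Model) → BinSym → U M → U M → Set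
interpB M `R  = R M
interpB M `R□ = R□ M
interpB M `R◇ = R◇ M

_∷ₑ_ : {A : Set} → A → (ℕ → A) → ℕ → A
(a ∷ₑ ρ) zero = a
(a ∷ₑ ρ) (suc n) = ρ n

Sat : (M : Model) → (ℕ → U M) → FO → Set
Sat M ρ ⊥ᶠ = ⊥
Sat M ρ (rel s x y) = interpB M s (ρ x) (ρ y)
Sat M ρ (pred n x) = P M n (ρ x)
Sat M ρ (φ ∧ᶠ ψ) = Sat M ρ φ × Sat M ρ ψ
Sat M ρ (φ ∨ᶠ ψ) = Sat M ρ φ ⊎ Sat M ρ ψ
Sat M ρ (φ ⇒ᶠ ψ) = Sat M ρ φ → Sat M ρ ψ
Sat M ρ (∀ᶠ φ) = (d : U M) → Sat M (d ∷ₑ ρ) φ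
Sat M ρ (∃ᶠ φ) = Σ (U M) λ d → Sat M (d ∷ₑ ρ) φ

data Idx : Set where
  one two : Idx

-- (2,2)-modal ⟨(M₁,t),(M₂,u)⟩_l-asimulations.
-- Tuples (a_1,…,a_m,a) are  as ∷ʳ a  with  as : Vec _ m.
-- Θ n  means  P_n ∈ Θ  (R, R_□, R_◇ are always in Θ).

record Asim (Θ : ℕ → Set) (M : Idx → Model) (t : U (M one)) (u : U (M two))
            (l : ℕ) : Set₁ where
  field
    A : (μ ν : Idx) {n : ℕ} → Vec (U (M μ)) (suc n) → Vec (U (M ν)) (suc n) → Set
    B : (μ ν : Idx) {n : ℕ} → Vec (U (M μ)) (suc n) → Vec (U (M ν)) (suc n) → Set
    A-mixed : ∀ {μ ν n} {xs : Vec (U (M μ)) (suc n)} {ys : Vec (U (M ν)) (suc n)} →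
              A μ ν xs ys → μ ≢ ν
    B-mixed : ∀ {μ ν n} {xs : Vec (U (M μ)) (suc n)} {ys : Vec (U (M ν)) (suc n)} →
              B μ ν xs ys → μ ≢ ν
    A-base : A one two (t ∷ []) (u ∷ [])
    A-atom : ∀ {μ ν m} (as : Vec (U (M μ)) m) (a : U (M μ))
               (bs : Vec (U (M ν)) m) (b : U (M ν)) (n : ℕ) → Θ n →
             A μ ν (as ∷ʳ a) (bs ∷ʳ b) → P (M μ) n a → P (M ν) n b
    A-forth : ∀ {μ ν m} (as : Vec (U (M μ)) m) (a : U (M μ))
                (bs : Vec (U (M ν)) m) (b d : U (M ν)) →
              A μ ν (as ∷ʳ a) (bs ∷ʳ b) → R (M ν) b d → m < l →
              Σ (U (M μ)) λ c → R (M μ) a c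
                × A μ ν ((as ∷ʳ a) ∷ʳ c) ((bs ∷ʳ b) ∷ʳ d)
                × A ν μ ((bs ∷ʳ b) ∷ʳ d) ((as ∷ʳ a) ∷ʳ c)
    A-box : ∀ {μ ν m} (as : Vec (U (M μ)) m) (a : U (M μ))
              (bs : Vec (U (M ν)) m) (b d f : U (M ν)) →
            A μ ν (as ∷ʳ a) (bs ∷ʳ b) → R (M ν) b d → R□ (M ν) d f → suc m < l →
            Σ (U (M μ)) λ c → Σ (U (M μ)) λ e → R (M μ) a c × R□ (M μ) c e
              × A μ ν (((as ∷ʳ a) ∷ʳ c) ∷ʳ e) (((bs ∷ʳ b) ∷ʳ d) ∷ʳ f)
    A-toB : ∀ {μ ν m} (as : Vec (U (M μ)) m) (a : U (M μ))
              (bs : Vec (U (M ν)) m) (b d : U (M ν)) →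
            A μ ν (as ∷ʳ a) (bs ∷ʳ b) → R (M ν) b d → suc m < l →
            Σ (U (M μ)) λ c → R (M μ) a c
              × B μ ν ((as ∷ʳ a) ∷ʳ c) ((bs ∷ʳ b) ∷ʳ d)
    B-dia : ∀ {μ ν m} (as : Vec (U (M μ)) m) (a c : U (M μ))
              (bs : Vec (U (M ν)) m) (b : U (M ν)) →
            B μ ν (as ∷ʳ a) (bs ∷ʳ b) → R◇ (M μ) a c → m < l →
            Σ (U (M ν)) λ d → R◇ (M ν) b d
              × A μ ν ((as ∷ʳ a) ∷ʳ c) ((bs ∷ʳ b) ∷ʳ d)

module Submission where

open import Defs
open import Data.Nat using (ℕ; suc; _+_; _≤_; _<_; _⊔_)
open import Data.Nat.Properties using (≤-trans; +-monoʳ-≤; +-suc; m≤m⊔n; m≤n⊔m; m+n≤o⇒m≤o)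
open import Data.Vec using (Vec; _∷ʳ_)
open import Data.Product using (Σ; _×_; _,_)
open import Data.Sum using (_⊎_; inj₁; inj₂)
open import Data.Empty using (⊥)
open import Relation.Binary.PropositionalEquality using (_≡_; refl; cong; cong₂; subst)

Forces : (M : Model) → U M → MIF → Set
Forces M w (p n)    = P M n w
Forces M w ⊥ᵐ       = ⊥
Forces M w (I ∧ᵐ J) = Forces M w I × Forces M w J
Forces M w (I ∨ᵐ J) = Forces M w I ⊎ Forces M w J
Forces M w (I ⇒ᵐ J) = (d : U M) → R M w d → Forces M d I → Forces M d J
Forces M w (□ᵐ I)   = (d : U M) → R M w d → (f : U M) → R□ M d f → Forces M f I
Forces M w (◇ᵐ I)   = (d : U M) → R M w d → Σ (U M) λ f → R◇ M d f × Forces M f I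

-- Correctness of the standard translation: M, ρ ⊨ ST22(I,x) iff ρ(x)
-- forces I.  The two directions are mutually recursive because of the
-- contravariant antecedent of ⇒.
st22→forces : (M : Model) (I : MIF) (ρ : ℕ → U M) (x : ℕ) →
              Sat M ρ (ST22 I x) → Forces M (ρ x) I
forces→st22 : (M : Model) (I : MIF) (ρ : ℕ → U M) (x : ℕ) →
              Forces M (ρ x) I → Sat M ρ (ST22 I x)

st22→forces M (p n)    ρ x s = s
st22→forces M ⊥ᵐ       ρ x s = s
st22→forces M (I ∧ᵐ J) ρ x (s , s′) = st22→forces M I ρ x s , st22→forces M J ρ x s′
st22→forces M (I ∨ᵐ J) ρ x (inj₁ s) = inj₁ (st22→forces M I ρ x s)
st22→forces M (I ∨ᵐ J) ρ x (inj₂ s) = inj₂ (st22→forces M J ρ x s)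
st22→forces M (I ⇒ᵐ J) ρ x s d xRd sI =
  st22→forces M J (d ∷ₑ ρ) 0 (s d xRd (forces→st22 M I (d ∷ₑ ρ) 0 sI))
st22→forces M (□ᵐ I)   ρ x s d xRd f dR□f =
  st22→forces M I (f ∷ₑ (d ∷ₑ ρ)) 0 (s d xRd f dR□f)
st22→forces M (◇ᵐ I)   ρ x s d xRd with s d xRd
... | f , dR◇f , sI = f , dR◇f , st22→forces M I (f ∷ₑ (d ∷ₑ ρ)) 0 sI

forces→st22 M (p n)    ρ x s = s
forces→st22 M ⊥ᵐ       ρ x s = s
forces→st22 M (I ∧ᵐ J) ρ x (s , s′) = forces→st22 M I ρ x s , forces→st22 M J ρ x s′
forces→st22 M (I ∨ᵐ J) ρ x (inj₁ s) = inj₁ (forces→st22 M I ρ x s)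
forces→st22 M (I ∨ᵐ J) ρ x (inj₂ s) = inj₂ (forces→st22 M J ρ x s)
forces→st22 M (I ⇒ᵐ J) ρ x s d xRd sI =
  forces→st22 M J (d ∷ₑ ρ) 0 (s d xRd (st22→forces M I (d ∷ₑ ρ) 0 sI))
forces→st22 M (□ᵐ I)   ρ x s d xRd f dR□f =
  forces→st22 M I (f ∷ₑ (d ∷ₑ ρ)) 0 (s d xRd f dR□f)
forces→st22 M (◇ᵐ I)   ρ x s d xRd with s d xRd
... | f , dR◇f , sI = f , dR◇f , forces→st22 M I (f ∷ₑ (d ∷ₑ ρ)) 0 sI

depth : MIF → ℕ
depth (p n)    = 0
depth ⊥ᵐ       = 0
depth (I ∧ᵐ J) = depth I ⊔ depth J
depth (I ∨ᵐ J) = depth I ⊔ depth J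
depth (I ⇒ᵐ J) = suc (depth I ⊔ depth J)
depth (□ᵐ I)   = suc (suc (depth I))
depth (◇ᵐ I)   = suc (suc (depth I))

r-ST22 : (I : MIF) (x : ℕ) → r (ST22 I x) ≡ depth I
r-ST22 (p n)    x = refl
r-ST22 ⊥ᵐ       x = refl
r-ST22 (I ∧ᵐ J) x = cong₂ _⊔_ (r-ST22 I x) (r-ST22 J x)
r-ST22 (I ∨ᵐ J) x = cong₂ _⊔_ (r-ST22 I x) (r-ST22 J x)
r-ST22 (I ⇒ᵐ J) x = cong suc (cong₂ _⊔_ (r-ST22 I 0) (r-ST22 J 0))
r-ST22 (□ᵐ I)   x = cong (λ k → suc (suc k)) (r-ST22 I 0)
r-ST22 (◇ᵐ I)   x = cong (λ k → suc (suc k)) (r-ST22 I 0)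

Letter : ℕ → MIF → Set
Letter n (p m)    = m ≡ n
Letter n ⊥ᵐ       = ⊥
Letter n (I ∧ᵐ J) = Letter n I ⊎ Letter n J
Letter n (I ∨ᵐ J) = Letter n I ⊎ Letter n J
Letter n (I ⇒ᵐ J) = Letter n I ⊎ Letter n J
Letter n (□ᵐ I)   = Letter n I
Letter n (◇ᵐ I)   = Letter n I

letter-of-ST22 : (I : MIF) (x n : ℕ) → Letter n I → PredOcc n (ST22 I x)
letter-of-ST22 (p m)    x n o = o
letter-of-ST22 (I ∧ᵐ J) x n (inj₁ o) = inj₁ (letter-of-ST22 I x n o)
letter-of-ST22 (I ∧ᵐ J) x n (inj₂ o) = inj₂ (letter-of-ST22 J x n o)
letter-of-ST22 (I ∨ᵐ J) x n (inj₁ o) = inj₁ (letter-of-ST22 I x n o)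
letter-of-ST22 (I ∨ᵐ J) x n (inj₂ o) = inj₂ (letter-of-ST22 J x n o)
letter-of-ST22 (I ⇒ᵐ J) x n (inj₁ o) = inj₂ (inj₁ (letter-of-ST22 I 0 n o))
letter-of-ST22 (I ⇒ᵐ J) x n (inj₂ o) = inj₂ (inj₂ (letter-of-ST22 J 0 n o))
letter-of-ST22 (□ᵐ I)   x n o = inj₂ (inj₂ (letter-of-ST22 I 0 n o))
letter-of-ST22 (◇ᵐ I)   x n o = inj₂ (inj₂ (letter-of-ST22 I 0 n o))

budget-⊔ˡ : ∀ m i j {l} → m + (i ⊔ j) ≤ l → m + i ≤ l
budget-⊔ˡ m i j h = ≤-trans (+-monoʳ-≤ m (m≤m⊔n i j)) h

budget-⊔ʳ : ∀ m i j {l} → m + (i ⊔ j) ≤ l → m + j ≤ l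
budget-⊔ʳ m i j h = ≤-trans (+-monoʳ-≤ m (m≤n⊔m i j)) h

budget-step : ∀ m k {l} → m + suc k ≤ l → suc m + k ≤ l
budget-step m k {l} h = subst (_≤ l) (+-suc m k) h

budget-room : ∀ m k {l} → m + suc k ≤ l → m < l
budget-room m k h = m+n≤o⇒m≤o (suc m) (budget-step m k h)

module Preservation {Θ : ℕ → Set} {M : Idx → Model} {t : U (M one)} {u : U (M two)}
                    {l : ℕ} (AB : Asim Θ M t u l) where
  open Asim AB

  -- For ⇒ the forth clause gives the pair in
  -- both directions, which handles the antecedent (transported from b's
  -- side to a's) and the consequent; □ uses the box clause; ◇ goes
  -- through B and back into A.
  preserve : (I : MIF) → (∀ n → Letter n I → Θ n) →
             ∀ {μ ν m} (as : Vec (U (M μ)) m) (a : U (M μ))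
               (bs : Vec (U (M ν)) m) (b : U (M ν)) →
             A μ ν (as ∷ʳ a) (bs ∷ʳ b) → m + depth I ≤ l →
             Forces (M μ) a I → Forces (M ν) b I
  preserve (p n) θ as a bs b h _ s = A-atom as a bs b n (θ n refl) h s
  preserve ⊥ᵐ θ as a bs b h _ ()
  preserve (I ∧ᵐ J) θ {m = m} as a bs b h k (sI , sJ) =
    preserve I (λ n o → θ n (inj₁ o)) as a bs b h (budget-⊔ˡ m _ _ k) sI ,
    preserve J (λ n o → θ n (inj₂ o)) as a bs b h (budget-⊔ʳ m _ _ k) sJ
  preserve (I ∨ᵐ J) θ {m = m} as a bs b h k (inj₁ sI) =
    inj₁ (preserve I (λ n o → θ n (inj₁ o)) as a bs b h (budget-⊔ˡ m _ _ k) sI)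
  preserve (I ∨ᵐ J) θ {m = m} as a bs b h k (inj₂ sJ) =
    inj₂ (preserve J (λ n o → θ n (inj₂ o)) as a bs b h (budget-⊔ʳ m _ _ k) sJ)
  preserve (I ⇒ᵐ J) θ {m = m} as a bs b h k s d bRd dI
    with A-forth as a bs b d h bRd (budget-room m _ k)
  ... | c , aRc , acAbd , bdAac =
    preserve J (λ n o → θ n (inj₂ o)) (as ∷ʳ a) c (bs ∷ʳ b) d acAbd (budget-⊔ʳ (suc m) _ _ k′)
      (s c aRc (preserve I (λ n o → θ n (inj₁ o)) (bs ∷ʳ b) d (as ∷ʳ a) c bdAac
                 (budget-⊔ˡ (suc m) _ _ k′) dI))
    where k′ = budget-step m _ k
  preserve (□ᵐ I) θ {m = m} as a bs b h k s d bRd f dR□f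
    with A-box as a bs b d f h bRd dR□f (budget-room (suc m) _ (budget-step m _ k))
  ... | c , e , aRc , cR□e , ceAdf =
    preserve I θ ((as ∷ʳ a) ∷ʳ c) e ((bs ∷ʳ b) ∷ʳ d) f ceAdf
      (budget-step (suc m) _ (budget-step m _ k)) (s c aRc e cR□e)
  preserve (◇ᵐ I) θ {m = m} as a bs b h k s d bRd
    with A-toB as a bs b d h bRd (budget-room (suc m) _ (budget-step m _ k))
  ... | c , aRc , acBbd with s c aRc
  ... | e , cR◇e , eI with B-dia (as ∷ʳ a) c e (bs ∷ʳ b) d acBbd cR◇e
                              (budget-room (suc m) _ (budget-step m _ k))
  ... | f , dR◇f , ceAdf =
    f , dR◇f , preserve I θ ((as ∷ʳ a) ∷ʳ c) e ((bs ∷ʳ b) ∷ʳ d) f ceAdf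
                 (budget-step (suc m) _ (budget-step m _ k)) eI

lemma1 : (I : MIF) (Θ : ℕ → Set) (M : Idx → Model)
         (t : U (M one)) (u : U (M two)) (l : ℕ) →
         (∀ n → PredOcc n (ST22 I 0) → Θ n) →
         (AB : Asim Θ M t u l) →
         (μ ν : Idx) (m : ℕ) (as : Vec (U (M μ)) m) (a : U (M μ))
         (bs : Vec (U (M ν)) m) (b : U (M ν)) →
         Asim.A AB μ ν (as ∷ʳ a) (bs ∷ʳ b) →
         m + r (ST22 I 0) ≤ l →
         Sat (M μ) (λ _ → a) (ST22 I 0) →
         Sat (M ν) (λ _ → b) (ST22 I 0)
lemma1 I Θ M t u l Σφ⊆Θ AB μ ν m as a bs b h k s =
  forces→st22 (M ν) I (λ _ → b) 0
    (Preservation.preserve AB I letters⊆Θ as a bs b h depth-bound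
      (st22→forces (M μ) I (λ _ → a) 0 s))
  where
  letters⊆Θ : ∀ n → Letter n I → Θ n
  letters⊆Θ n o = Σφ⊆Θ n (letter-of-ST22 I 0 n o)

  depth-bound : m + depth I ≤ l
  depth-bound = subst (λ d → m + d ≤ l) (r-ST22 I 0) k
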